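{- Let $n,k$ be integers with $2\le k\le n-2$ and let $C_n^k$ be the circulant matrix defined in the context. Let $W\subset\mathbb{Z}_n$ be a subset defining a circulant minor of $C_n^k$ isomorphic to $C_{n'}^{k'}$. Then the inequality \[ \sum_{i\in W} 2x_i+\sum_{i\in\mathbb{Z}_n\setminus W} x_i\ \ge\ \left\lceil \frac{n'}{k'}\right\rceil \] is valid for $Q^*(C_n^k)$. Moreover, it is a Chvátal–Gomory inequality of rank at most one with respect to $Q(C_n^k)=\{x\in[0,1]^n: C_n^kx\ge \mathbf{1}\}$.
   Context: $\mathbb{Z}_n=\{0,\dots,n-1\}$ with arithmetic modulo $n$. For $2\le k\le n-2$, $C_n^k$ is the $n\times n$ $0,1$ matrix with rows and columns indexed by $\mathbb{Z}_n$ whose $i$-th row is the incidence vector of $C^i=\{i,i+1,\dots,i+k-1\}\subset\mathbb{Z}_n$. A cover of a $0,1$ matrix $A$ with $n$ columns is $x\in\{0,1\}^n$ with $Ax\ge\mathbf 1$; $Q^*(A)$ is the convex hull of the covers of $A$. For a $0,1$ matrix $A$ with rows indexed by $\mathbb{Z}_m$ and columns by $\mathbb{Z}_n$ and $N\subset\mathbb{Z}_n$, let $R(N)$ be the set of rows $j$ such that row $j$ of the column-submatrix $A_{\mathbb{Z}_m,\mathbb{Z}_n\setminus N}$ entrywise dominates some other row of that submatrix; the minor $A/N$ is the submatrix with rows $\mathbb{Z}_m\setminus R(N)$ and columns $\mathbb{Z}_n\setminus N$. Two matrices are isomorphic if one is obtained from the other by permuting rows and columns; a circulant minor of $C_n^k$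 is a minor $C_n^k/N$ isomorphic to some circulant matrix $C_{n'}^{k'}$. Let $G(C_n^k)$ be the digraph on $\mathbb{Z}_n$ with arcs $(i,i+k)$ (length $k$) and $(i,i+k+1)$ (length $k+1$). It is known that $C_n^k/N\approx C_{n'}^{k'}$ if and only if $N$ is the disjoint union of sets $N^0,\dots,N^{d-1}$, each the vertex set of a simple directed cycle of $G(C_n^k)$, all cycles having the same number $n_2$ of arcs of length $k$ and $n_3$ of arcs of length $k+1$, where $n_1n=kn_2+(k+1)n_3$ for a positive integer $n_1$, and $n'=n-d(n_2+n_3)$, $k'=k-dn_1$ ($d,n_1,n_2,n_3$ are the parameters of the minor). With $W^j=\{i\in N^j: i-(k+1)\in N^j\}$ and $W=\bigcup_j W^j$, the set $W$ determines $N$ and the minor; one says $W$ defines the minor. -}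

module Defs where

open import Data.Nat using (ℕ; zero; suc; _+_; _*_; _∸_; _≤_; _<_; _%_; _/_; _<ᵇ_; NonZero)
open import Data.Nat.DivMod using (_mod_)
open import Data.Fin using (Fin; toℕ)
open import Data.Bool using (Bool; true; false; if_then_else_)
open import Data.Product using (Σ; ∃; _×_; _,_)
open import Data.Integer using (ℤ; +_)
open import Data.Rational as ℚ using (ℚ; 0ℚ; 1ℚ; ceiling)
open import Relation.Binary.PropositionalEquality using (_≡_; _≢_)
open import Function.Bundles using (_⇔_)

-- Z_n is represented by Fin n; arithmetic modulo n.

shift : ∀ {n} .{{_ : NonZero n}} → Fin n → ℕ → Fin n
shift {n} i a = (toℕ i + a) mod n

-- i - a  in Z_n  (for a ≤ n)
unshift : ∀ {n} .{{_ : NonZero n}} → Fin n → ℕ → Fin n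
unshift {n} i a = (toℕ i + (n ∸ a)) mod n

Σℕ : ∀ {n} → (Fin n → ℕ) → ℕ
Σℕ {zero}  f = 0
Σℕ {suc n} f = f Fin.zero + Σℕ (λ i → f (Fin.suc i))
  where import Data.Fin as Fin

Σℚ : ∀ {n} → (Fin n → ℚ) → ℚ
Σℚ {zero}  f = 0ℚ
Σℚ {suc n} f = f Fin.zero ℚ.+ Σℚ (λ i → f (Fin.suc i))
  where import Data.Fin as Fin

b2n : Bool → ℕ
b2n true  = 1
b2n false = 0

ℕ→ℚ : ℕ → ℚ
ℕ→ℚ m = (+ m) ℚ./ 1

-- ceiling of a / b for naturals (b ≥ 1); value 0 if b = 0 (never used)
ceilDiv : ℕ → ℕ → ℕ
ceilDiv a zero    = 0
ceilDiv a (suc b) = (a + b) / suc b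

-- The circulant matrix C_n^k: row i is the incidence vector of
-- C^i = {i, i+1, ..., i+k-1} ⊂ Z_n, i.e. entry (i,j) is 1 iff (j - i) mod n < k.

C : (n k : ℕ) .{{_ : NonZero n}} → Fin n → Fin n → ℕ
C n k i j = b2n (((toℕ j + (n ∸ toℕ i)) % n) <ᵇ k)

IsCover : (n k : ℕ) .{{_ : NonZero n}} → (Fin n → Bool) → Set
IsCover n k x = ∀ (i : Fin n) → 1 ≤ Σℕ (λ j → C n k i j * b2n (x j))

-- Simple directed cycles of G(C_n^k) with n2 arcs of length k and
-- n3 arcs of length k+1.  The cycle is v_0 → v_1 → … → v_{m-1} → v_m = v_0,
-- m = n2 + n3, with v_0,…,v_{m-1} pairwise distinct; long t says whether
-- the arc v_t → v_{t+1} has length k+1 (true) or k (false).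

countTrue : (ℕ → Bool) → ℕ → ℕ
countTrue f zero    = 0
countTrue f (suc m) = countTrue f m + b2n (f m)

record Cycle (n k : ℕ) .{{_ : NonZero n}} (n2 n3 : ℕ) : Set where
  field
    vert   : ℕ → Fin n
    long   : ℕ → Bool
    step   : ∀ t → t < n2 + n3 →
             vert (suc t) ≡ shift (vert t) (k + b2n (long t))
    closed : vert (n2 + n3) ≡ vert 0
    simple : ∀ s t → s < n2 + n3 → t < n2 + n3 → vert s ≡ vert t → s ≡ t
    nLong  : countTrue long (n2 + n3) ≡ n3

InCycle : ∀ {n k} .{{_ : NonZero n}} {n2 n3} → Cycle n k n2 n3 → Fin n → Set
InCycle {n2 = n2} {n3} c i = ∃ λ t → t < n2 + n3 × Cycle.vert c t ≡ i

-- W ⊆ Z_n (given by its characteristic function) defines a circulant minor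
-- C_n^k / N ≈ C_{n'}^{k'} with parameters d, n1, n2, n3:
-- N = N^0 ⊔ … ⊔ N^{d-1}, N^j the vertex set of a simple directed cycle of
-- G(C_n^k) with n2 arcs of length k and n3 of length k+1,
-- n1 n = k n2 + (k+1) n3 with n1 ≥ 1, n' = n - d(n2+n3), k' = k - d n1,
-- 2 ≤ k' ≤ n' - 2 (C_{n'}^{k'} is a circulant), and
-- W = ⋃_j W^j with W^j = { i ∈ N^j : i - (k+1) ∈ N^j }.

record DefinesMinor (n k : ℕ) .{{_ : NonZero n}} (W : Fin n → Bool) (n' k' : ℕ) : Set where
  field
    d n1 n2 n3 : ℕ
    cyc        : Fin d → Cycle n k n2 n3
    n1-pos     : 1 ≤ n1
    n1-eq      : n1 * n ≡ k * n2 + (k + 1) * n3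
    disjoint   : ∀ j j' (i : Fin n) → InCycle (cyc j) i → InCycle (cyc j') i → j ≡ j'
    n'-eq      : n' + d * (n2 + n3) ≡ n
    k'-eq      : k' + d * n1 ≡ k
    k'-lo      : 2 ≤ k'
    k'-hi      : k' + 2 ≤ n'
    W-def      : ∀ (i : Fin n) →
                 (W i ≡ true) ⇔ (∃ λ j → InCycle (cyc j) i × InCycle (cyc j) (unshift i (k + 1)))

coef : ∀ {n} → (Fin n → Bool) → Fin n → ℕ
coef W i = if W i then 2 else 1

-- Validity for Q*(C_n^k): holds at every cover (equivalently at every point
-- of their convex hull, as the inequality is linear).
ValidQ* : (n k : ℕ) .{{_ : NonZero n}} → (Fin n → ℕ) → ℕ → Set
ValidQ* n k a β = ∀ x → IsCover n k x → β ≤ Σℕ (λ i → a i * b2n (x i))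

-- a x ≥ β is a Chvátal–Gomory inequality of rank at most one w.r.t.
-- Q(C_n^k) = { x ∈ [0,1]^n : C x ≥ 1 }: there are nonnegative rational
-- multipliers u (for C x ≥ 1), v (for x ≥ 0), w (for -x ≥ -1) such that
-- the CG cut  ⌈uᵀC + vᵀ - wᵀ⌉ x ≥ ⌈uᵀ1 - wᵀ1⌉  has left-hand side a x and
-- right-hand side at least β.
CGRank≤1 : (n k : ℕ) .{{_ : NonZero n}} → (Fin n → ℕ) → ℕ → Set
CGRank≤1 n k a β =
  Σ (Fin n → ℚ) λ u → Σ (Fin n → ℚ) λ v → Σ (Fin n → ℚ) λ w →
    (∀ i → 0ℚ ℚ.≤ u i) × (∀ i → 0ℚ ℚ.≤ v i) × (∀ i → 0ℚ ℚ.≤ w i) ×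
    (∀ j → ceiling (Σℚ (λ i → u i ℚ.* ℕ→ℚ (C n k i j)) ℚ.+ v j ℚ.- w j) ≡ + a j) ×
    (+ β Data.Integer.≤ ceiling (Σℚ u ℚ.- Σℚ w))

module Submission where

-- Let b_i = 1 if i - 1 ∉ N and b_i = 0 otherwise; exactly n' rows have
-- b_i = 1. The heart of the proof is the column bound
--   Σ_i b_i (C_n^k)_ij ≤ a_j k',   a_j = 2 if j ∈ W, 1 otherwise.
-- Column j meets the k rows j-k+1, …, j; row v+1 is deleted for every v ∈ N.
-- Each cycle N^c of G(C_n^k) winds n1 times around Z_n, so exactly n1 of its
-- arcs v → v+ℓ pass over j; such an arc has v+1 in a row meeting j, unless it
-- is a long arc ending exactly at j, and at most one such arc exists, which
-- forces j ∈ W. Hence at least d·n1 - [j ∈ W] rows meeting j are deleted and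
-- the column bound follows from k = k' + d·n1. Given the column bound, double
-- counting yields validity, and the multipliers b/k' on C x ≥ 1 (plus slack on
-- x ≥ 0) give the Chvátal–Gomory derivation.

open import Defs
open import Level using (Level)
open import Data.Nat
  using (ℕ; zero; suc; _+_; _*_; _∸_; _≤_; _<_; _%_; _/_; NonZero; z≤n; s≤s; _≟_; _<?_; _≤?_)
open import Data.Nat.Properties
open import Data.Nat.DivMod
open import Data.Nat.Divisibility using (n∣m*n)
open import Data.Nat.Coprimality using (Coprime)
open import Data.Nat.Tactic.RingSolver using (solve-∀)
open import Data.Fin as Fin using (Fin; toℕ)
import Data.Fin.Properties as Fin
open import Data.Bool using (Bool; true; false)
open import Data.Empty using (⊥-elim)
open import Data.Product using (∃; _×_; _,_)
open import Data.Sum using (inj₁; inj₂)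
import Data.Integer.Properties as ℤ
import Data.Integer.Tactic.RingSolver as ℤ-Solver
open import Data.Rational as ℚ using (ℚ; mkℚ; 0ℚ; ceiling; fromℚᵘ; toℚᵘ)
import Data.Rational.Properties as ℚ
open import Data.Rational.Unnormalised as ℚᵘ using (mkℚᵘ; *≡*)
import Data.Rational.Unnormalised.Properties as ℚᵘ
open import Function using (_∘_)
open import Function.Bundles using (Equivalence)
open import Relation.Nullary using (Dec; yes; no; does; ¬_)
open import Relation.Binary.Definitions using (tri<; tri≈; tri>)
open import Relation.Binary.PropositionalEquality

private
  variable
    ℓ₁ ℓ₂ : Level
    P : Set ℓ₁
    Q : Set ℓ₂
    m n : ℕ

⟦_⟧ : Dec P → ℕ
⟦ d ⟧ = b2n (does d)

⟦⟧-yes : (d : Dec P) → P → ⟦ d ⟧ ≡ 1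
⟦⟧-yes (yes _) _ = refl
⟦⟧-yes (no ¬p) p = ⊥-elim (¬p p)

⟦⟧-no : (d : Dec P) → ¬ P → ⟦ d ⟧ ≡ 0
⟦⟧-no (yes p) ¬p = ⊥-elim (¬p p)
⟦⟧-no (no _)  _  = refl

⟦⟧-sound : (d : Dec P) → 1 ≤ ⟦ d ⟧ → P
⟦⟧-sound (yes p) _ = p

b2n≤1 : ∀ b → b2n b ≤ 1
b2n≤1 true  = s≤s z≤n
b2n≤1 false = z≤n

⟦⟧≤1 : (d : Dec P) → ⟦ d ⟧ ≤ 1
⟦⟧≤1 d = b2n≤1 (does d)

∧-indicator-sound : ∀ b (d : Dec P) → 1 ≤ b2n b * ⟦ d ⟧ → b ≡ true × P
∧-indicator-sound true  d p = refl , ⟦⟧-sound d (subst (1 ≤_) (+-identityʳ _) p)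
∧-indicator-sound false d ()

∧-indicator≤1 : ∀ b (d : Dec P) → b2n b * ⟦ d ⟧ ≤ 1
∧-indicator≤1 true  d = subst (_≤ 1) (sym (+-identityʳ _)) (⟦⟧≤1 d)
∧-indicator≤1 false d = z≤n

⟦⟧-cong : (P → Q) → (Q → P) → (d : Dec P) (e : Dec Q) → ⟦ d ⟧ ≡ ⟦ e ⟧
⟦⟧-cong to from (yes p) e = sym (⟦⟧-yes e (to p))
⟦⟧-cong to from (no ¬p) e = sym (⟦⟧-no e (λ q → ¬p (from q)))

⟦<suc⟧ : ∀ x k → ⟦ x <? suc k ⟧ ≡ ⟦ x <? k ⟧ + ⟦ x ≟ k ⟧
⟦<suc⟧ x k with <-cmp x k
... | tri< x<k x≢k _ = trans (⟦⟧-yes (x <? suc k) (m<n⇒m<1+n x<k))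
                            (sym (cong₂ _+_ (⟦⟧-yes (x <? k) x<k) (⟦⟧-no (x ≟ k) x≢k)))
... | tri≈ x≮k refl _ = trans (⟦⟧-yes (x <? suc k) ≤-refl)
                             (sym (cong₂ _+_ (⟦⟧-no (x <? k) x≮k) (⟦⟧-yes (x ≟ k) refl)))
... | tri> x≮k x≢k k<x = trans (⟦⟧-no (x <? suc k) (λ x<1+k → <-asym k<x (≤∧≢⇒< (≤-pred x<1+k) x≢k)))
                              (sym (cong₂ _+_ (⟦⟧-no (x <? k) x≮k) (⟦⟧-no (x ≟ k) x≢k)))

Σℕ-cong : {f g : Fin n → ℕ} → (∀ i → f i ≡ g i) → Σℕ f ≡ Σℕ g
Σℕ-cong {zero}  e = refl
Σℕ-cong {suc n} e = cong₂ _+_ (e Fin.zero) (Σℕ-cong (λ i → e (Fin.suc i)))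

Σℕ-mono : {f g : Fin n → ℕ} → (∀ i → f i ≤ g i) → Σℕ f ≤ Σℕ g
Σℕ-mono {zero}  e = z≤n
Σℕ-mono {suc n} e = +-mono-≤ (e Fin.zero) (Σℕ-mono (λ i → e (Fin.suc i)))

Σℕ-+ : (f g : Fin n → ℕ) → Σℕ (λ i → f i + g i) ≡ Σℕ f + Σℕ g
Σℕ-+ {zero}  f g = refl
Σℕ-+ {suc n} f g = begin
  f₀ + g₀ + Σℕ (λ i → f (Fin.suc i) + g (Fin.suc i)) ≡⟨ cong (f₀ + g₀ +_) (Σℕ-+ (f ∘ Fin.suc) (g ∘ Fin.suc)) ⟩
  f₀ + g₀ + (Σℕ (f ∘ Fin.suc) + Σℕ (g ∘ Fin.suc))    ≡⟨ interchange f₀ g₀ _ _ ⟩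
  f₀ + Σℕ (f ∘ Fin.suc) + (g₀ + Σℕ (g ∘ Fin.suc))    ∎
  where
  open ≡-Reasoning
  f₀ = f Fin.zero
  g₀ = g Fin.zero
  interchange : ∀ a b c d → a + b + (c + d) ≡ a + c + (b + d)
  interchange = solve-∀

Σℕ-const : ∀ n c → Σℕ {n} (λ _ → c) ≡ n * c
Σℕ-const zero    c = refl
Σℕ-const (suc n) c = cong (c +_) (Σℕ-const n c)

Σℕ-zero : ∀ n → Σℕ {n} (λ _ → 0) ≡ 0
Σℕ-zero n = trans (Σℕ-const n 0) (*-zeroʳ n)

Σℕ-*ˡ : ∀ c (f : Fin n → ℕ) → Σℕ (λ i → c * f i) ≡ c * Σℕ f
Σℕ-*ˡ {zero}  c f = sym (*-zeroʳ c)
Σℕ-*ˡ {suc n} c f = trans (cong (c * f Fin.zero +_) (Σℕ-*ˡ c (λ i → f (Fin.suc i)))) (sym (*-distribˡ-+ c _ _))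

Σℕ-swap : (f : Fin m → Fin n → ℕ) → Σℕ (λ i → Σℕ (f i)) ≡ Σℕ (λ j → Σℕ (λ i → f i j))
Σℕ-swap {zero} {n} f = sym (Σℕ-zero n)
Σℕ-swap {suc m} f = trans (cong (Σℕ (f Fin.zero) +_) (Σℕ-swap (λ i → f (Fin.suc i))))
                          (sym (Σℕ-+ (f Fin.zero) _))

Σℕ-*ʳ : ∀ c (f : Fin n → ℕ) → Σℕ (λ i → f i * c) ≡ Σℕ f * c
Σℕ-*ʳ {zero}  c f = refl
Σℕ-*ʳ {suc n} c f = trans (cong (f Fin.zero * c +_) (Σℕ-*ʳ c (λ i → f (Fin.suc i)))) (sym (*-distribʳ-+ c (f Fin.zero) _))

Σℕ-point : (x : Fin n) (f : Fin n → ℕ) → Σℕ (λ i → ⟦ x Fin.≟ i ⟧ * f i) ≡ f x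
Σℕ-point {suc n} Fin.zero f =
  trans (cong₂ _+_ (+-identityʳ (f Fin.zero)) (Σℕ-zero n)) (+-identityʳ _)
Σℕ-point {suc n} (Fin.suc x) f = Σℕ-point x (λ i → f (Fin.suc i))

Σℕ-witness : (f : Fin n → ℕ) → 1 ≤ Σℕ f → ∃ λ i → 1 ≤ f i
Σℕ-witness {suc n} f p with f Fin.zero in eq
... | suc _ = Fin.zero , ≤-trans (s≤s z≤n) (≤-reflexive (sym eq))
... | zero with Σℕ-witness (λ i → f (Fin.suc i)) p
...   | i , q = Fin.suc i , q

Σℕ-≤1 : (f : Fin n → ℕ) → (∀ i → f i ≤ 1) →
        (∀ i j → 1 ≤ f i → 1 ≤ f j → i ≡ j) → Σℕ f ≤ 1
Σℕ-≤1 {zero}  f bound unique = z≤n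
Σℕ-≤1 {suc n} f bound unique with f Fin.zero in eq
... | zero  = Σℕ-≤1 (λ i → f (Fin.suc i)) (λ i → bound (Fin.suc i))
                (λ i j p q → Fin.suc-injective (unique _ _ p q))
... | suc x = begin
  suc x + Σℕ (λ i → f (Fin.suc i)) ≡⟨ cong (suc x +_) (trans (Σℕ-cong rest-zero) (Σℕ-zero n)) ⟩
  suc x + 0                        ≡⟨ trans (+-identityʳ _) (sym eq) ⟩
  f Fin.zero                       ≤⟨ bound Fin.zero ⟩
  1                                ∎
  where
  open ≤-Reasoning
  zero-pos : 1 ≤ f Fin.zero
  zero-pos = ≤-trans (s≤s z≤n) (≤-reflexive (sym eq))
  rest-zero : ∀ i → f (Fin.suc i) ≡ 0
  rest-zero i with f (Fin.suc i) in eq′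
  ... | zero  = refl
  ... | suc _ with unique Fin.zero (Fin.suc i) zero-pos (≤-trans (s≤s z≤n) (≤-reflexive (sym eq′)))
  ...   | ()

Σ< : ℕ → (ℕ → ℕ) → ℕ
Σ< L f = Σℕ {L} (λ t → f (toℕ t))

Σ<-snoc : ∀ L f → Σ< (suc L) f ≡ Σ< L f + f L
Σ<-snoc zero    f = +-identityʳ (f 0)
Σ<-snoc (suc L) f = trans (cong (f 0 +_) (Σ<-snoc L (f ∘ suc))) (sym (+-assoc (f 0) _ _))

countTrue-Σ< : ∀ f L → countTrue f L ≡ Σ< L (b2n ∘ f)
countTrue-Σ< f zero    = refl
countTrue-Σ< f (suc L) = trans (cong (_+ b2n (f L)) (countTrue-Σ< f L)) (sym (Σ<-snoc L (b2n ∘ f)))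

Σ<-cong : ∀ L {f g : ℕ → ℕ} → (∀ t → f t ≡ g t) → Σ< L f ≡ Σ< L g
Σ<-cong L e = Σℕ-cong {L} (λ t → e (toℕ t))

Σ<-+ : ∀ L (f g : ℕ → ℕ) → Σ< L (λ t → f t + g t) ≡ Σ< L f + Σ< L g
Σ<-+ L f g = Σℕ-+ {L} (f ∘ toℕ) (g ∘ toℕ)

count-injective : (g : Fin n → ℕ) → (∀ i i′ → g i ≡ g i′ → i ≡ i′) →
                  ∀ k → Σℕ (λ i → ⟦ g i <? k ⟧) ≤ k
count-injective {n} g inj zero = ≤-reflexive (begin
  Σℕ (λ i → ⟦ g i <? 0 ⟧) ≡⟨ Σℕ-cong (λ i → ⟦⟧-no (g i <? 0) λ ()) ⟩
  Σℕ {n} (λ _ → 0)       ≡⟨ Σℕ-zero n ⟩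
  0                      ∎)
  where open ≡-Reasoning
count-injective g inj (suc k) = begin
  Σℕ (λ i → ⟦ g i <? suc k ⟧)                        ≡⟨ Σℕ-cong (λ i → ⟦<suc⟧ (g i) k) ⟩
  Σℕ (λ i → ⟦ g i <? k ⟧ + ⟦ g i ≟ k ⟧)              ≡⟨ Σℕ-+ (λ i → ⟦ g i <? k ⟧) (λ i → ⟦ g i ≟ k ⟧) ⟩
  Σℕ (λ i → ⟦ g i <? k ⟧) + Σℕ (λ i → ⟦ g i ≟ k ⟧)  ≤⟨ +-mono-≤ (count-injective g inj k) (Σℕ-≤1 _ (λ i → ⟦⟧≤1 (g i ≟ k)) at-most-one) ⟩
  k + 1                                              ≡⟨ +-comm k 1 ⟩
  suc k                                              ∎
  where
  open ≤-Reasoning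
  at-most-one : ∀ i i′ → 1 ≤ ⟦ g i ≟ k ⟧ → 1 ≤ ⟦ g i′ ≟ k ⟧ → i ≡ i′
  at-most-one i i′ p q = inj i i′ (trans (⟦⟧-sound (g i ≟ k) p) (sym (⟦⟧-sound (g i′ ≟ k) q)))

module ZMod (n : ℕ) .{{_ : NonZero n}} where

  open ≡-Reasoning

  mod-addˡ : ∀ a b → (a % n + b) % n ≡ (a + b) % n
  mod-addˡ a b = begin
    (a % n + b) % n           ≡⟨ %-distribˡ-+ (a % n) b n ⟩
    (a % n % n + b % n) % n   ≡⟨ cong (λ z → (z + b % n) % n) (m%n%n≡m%n a n) ⟩
    (a % n + b % n) % n       ≡⟨ %-distribˡ-+ a b n ⟨
    (a + b) % n               ∎

  toℕ-shift : ∀ (x : Fin n) a → toℕ (shift x a) ≡ (toℕ x + a) % n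
  toℕ-shift x a = Fin.toℕ-fromℕ< _

  shift-shift : ∀ (x : Fin n) a b → shift (shift x a) b ≡ shift x (a + b)
  shift-shift x a b = Fin.toℕ-injective (begin
    toℕ (shift (shift x a) b)  ≡⟨ toℕ-shift (shift x a) b ⟩
    (toℕ (shift x a) + b) % n  ≡⟨ cong (λ z → (z + b) % n) (toℕ-shift x a) ⟩
    ((toℕ x + a) % n + b) % n  ≡⟨ mod-addˡ (toℕ x + a) b ⟩
    (toℕ x + a + b) % n        ≡⟨ cong (_% n) (+-assoc (toℕ x) a b) ⟩
    (toℕ x + (a + b)) % n      ≡⟨ toℕ-shift x (a + b) ⟨
    toℕ (shift x (a + b))      ∎)

  shift-n : ∀ (x : Fin n) → shift x n ≡ x
  shift-n x = Fin.toℕ-injective (begin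
    toℕ (shift x n)   ≡⟨ toℕ-shift x n ⟩
    (toℕ x + n) % n   ≡⟨ [m+n]%n≡m%n (toℕ x) n ⟩
    toℕ x % n         ≡⟨ m<n⇒m%n≡m (Fin.toℕ<n x) ⟩
    toℕ x             ∎)

  unshift-shift : ∀ (x : Fin n) {a} → a ≤ n → unshift (shift x a) a ≡ x
  unshift-shift x {a} a≤n = trans (shift-shift x a (n ∸ a))
                                  (trans (cong (shift x) (m+[n∸m]≡n a≤n)) (shift-n x))

  shift-injective : ∀ {x y : Fin n} {a} → a ≤ n → shift x a ≡ shift y a → x ≡ y
  shift-injective {x} {y} {a} a≤n eq =
    trans (sym (unshift-shift x a≤n)) (trans (cong (λ z → unshift z a) eq) (unshift-shift y a≤n))

  -- dist i j is the forward distance from i to j in Z_n; C n k i j = [dist i j < k].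
  dist : Fin n → Fin n → ℕ
  dist i j = (toℕ j + (n ∸ toℕ i)) % n

  dist<n : ∀ i j → dist i j < n
  dist<n i j = m%n<n _ n

  shift-dist : ∀ i j → shift i (dist i j) ≡ j
  shift-dist i j = Fin.toℕ-injective (begin
    toℕ (shift i (dist i j))                  ≡⟨ toℕ-shift i (dist i j) ⟩
    (toℕ i + (toℕ j + (n ∸ toℕ i)) % n) % n  ≡⟨ cong (_% n) (+-comm (toℕ i) _) ⟩
    ((toℕ j + (n ∸ toℕ i)) % n + toℕ i) % n  ≡⟨ mod-addˡ (toℕ j + (n ∸ toℕ i)) (toℕ i) ⟩
    (toℕ j + (n ∸ toℕ i) + toℕ i) % n        ≡⟨ cong (_% n) (+-assoc (toℕ j) _ _) ⟩
    (toℕ j + ((n ∸ toℕ i) + toℕ i)) % n      ≡⟨ cong (λ z → (toℕ j + z) % n) (m∸n+n≡m (<⇒≤ (Fin.toℕ<n i))) ⟩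
    (toℕ j + n) % n                          ≡⟨ toℕ-shift j n ⟨
    toℕ (shift j n)                          ≡⟨ cong toℕ (shift-n j) ⟩
    toℕ j                                    ∎)

  dist-injective : ∀ {i i′} j → dist i j ≡ dist i′ j → i ≡ i′
  dist-injective {i} {i′} j eq = shift-injective (<⇒≤ (dist<n i′ j))
    (trans (cong (shift i) (sym eq)) (trans (shift-dist i j) (sym (shift-dist i′ j))))

  shift-fixed : ∀ (x : Fin n) m → shift x m ≡ x → m % n ≡ 0
  shift-fixed x m fixed = begin
    m % n                               ≡⟨ [m+n]%n≡m%n m n ⟨
    (m + n) % n                         ≡⟨ cong (_% n) (+-comm m n) ⟩
    (n + m) % n                         ≡⟨ cong (λ z → (z + m) % n) (m∸n+n≡m x≤n) ⟨
    ((n ∸ toℕ x) + toℕ x + m) % n       ≡⟨ cong (_% n) (+-assoc (n ∸ toℕ x) (toℕ x) m) ⟩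
    ((n ∸ toℕ x) + (toℕ x + m)) % n     ≡⟨ mod-addʳ (n ∸ toℕ x) (toℕ x + m) ⟨
    ((n ∸ toℕ x) + (toℕ x + m) % n) % n ≡⟨ cong (λ z → ((n ∸ toℕ x) + z) % n) (trans (sym (toℕ-shift x m)) (cong toℕ fixed)) ⟩
    ((n ∸ toℕ x) + toℕ x) % n           ≡⟨ cong (_% n) (m∸n+n≡m x≤n) ⟩
    n % n                               ≡⟨ n%n≡0 n ⟩
    0                                   ∎
    where
    x≤n = <⇒≤ (Fin.toℕ<n x)
    mod-addʳ : ∀ a b → (a + b % n) % n ≡ (a + b) % n
    mod-addʳ a b = trans (cong (_% n) (+-comm a (b % n)))
                         (trans (mod-addˡ b a) (cong (_% n) (+-comm b a)))

  multiple-between : ∀ m → m % n ≡ 0 → 0 < m → m < 2 * n → m ≡ n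
  multiple-between m m%n≡0 0<m m<2n = trans m≡q*n (trans (cong (_* n) q≡1) (*-identityˡ n))
    where
    q = m / n
    m≡q*n : m ≡ q * n
    m≡q*n = trans (m≡m%n+[m/n]*n m n) (cong (_+ q * n) m%n≡0)
    q≡1 : q ≡ 1
    q≡1 with q in eq
    ... | zero = ⊥-elim (<-irrefl (sym (trans m≡q*n (cong (_* n) eq))) 0<m)
    ... | suc zero = refl
    ... | suc (suc _) = ⊥-elim (<⇒≱ (m<n*o⇒m/o<n m<2n) (≤-trans (s≤s (s≤s z≤n)) (≤-reflexive (sym eq))))

  -- Going from v+1 to j and then from j back to v covers Z_n exactly once, minus one step.
  dist-complement : ∀ v j → dist (shift v 1) j + suc (dist j v) ≡ n
  dist-complement v j = multiple-between loop (shift-fixed v loop around) (≤-trans (s≤s z≤n) (m≤n+m (suc b) a)) loop<2n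
    where
    a = dist (shift v 1) j
    b = dist j v
    loop = a + suc b
    around : shift v loop ≡ v
    around = begin
      shift v (a + suc b)          ≡⟨ cong (shift v) (+-suc a b) ⟩
      shift v (1 + a + b)          ≡⟨ shift-shift v (1 + a) b ⟨
      shift (shift v (1 + a)) b    ≡⟨ cong (λ z → shift z b) (shift-shift v 1 a) ⟨
      shift (shift (shift v 1) a) b ≡⟨ cong (λ z → shift z b) (shift-dist (shift v 1) j) ⟩
      shift j b                    ≡⟨ shift-dist j v ⟩
      v                            ∎
    loop<2n : loop < 2 * n
    loop<2n = subst (loop <_) (cong (n +_) (sym (+-identityʳ n)))
                 (+-mono-<-≤ (dist<n (shift v 1) j) (dist<n j v))

  dist-shift : ∀ j v ℓ → dist j (shift v ℓ) ≡ (dist j v + ℓ) % n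
  dist-shift j v ℓ = begin
    (toℕ (shift v ℓ) + (n ∸ toℕ j)) % n  ≡⟨ cong (λ z → (z + (n ∸ toℕ j)) % n) (toℕ-shift v ℓ) ⟩
    ((toℕ v + ℓ) % n + (n ∸ toℕ j)) % n  ≡⟨ mod-addˡ (toℕ v + ℓ) (n ∸ toℕ j) ⟩
    (toℕ v + ℓ + (n ∸ toℕ j)) % n        ≡⟨ cong (_% n) (swap (toℕ v) ℓ (n ∸ toℕ j)) ⟩
    (toℕ v + (n ∸ toℕ j) + ℓ) % n        ≡⟨ mod-addˡ (toℕ v + (n ∸ toℕ j)) ℓ ⟨
    (dist j v + ℓ) % n                   ∎
    where
    swap : ∀ a b c → a + b + c ≡ a + c + b
    swap = solve-∀

  wrap : ∀ {r ℓ} → r < n → ℓ ≤ n → (r + ℓ) % n + n * ⟦ n ≤? r + ℓ ⟧ ≡ r + ℓ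
  wrap {r} {ℓ} r<n ℓ≤n with n ≤? r + ℓ
  ... | no  r+ℓ≱n = begin
    (r + ℓ) % n + n * ⟦ n ≤? r + ℓ ⟧ ≡⟨ cong₂ _+_ (m<n⇒m%n≡m (≰⇒> r+ℓ≱n)) (cong (n *_) (⟦⟧-no (n ≤? r + ℓ) r+ℓ≱n)) ⟩
    r + ℓ + n * 0                    ≡⟨ cong (r + ℓ +_) (*-zeroʳ n) ⟩
    r + ℓ + 0                        ≡⟨ +-identityʳ _ ⟩
    r + ℓ                            ∎
  ... | yes n≤r+ℓ = begin
    (r + ℓ) % n + n * ⟦ n ≤? r + ℓ ⟧ ≡⟨ cong₂ _+_ (sym (m≤n⇒[n∸m]%m≡n%m n≤r+ℓ)) (cong (n *_) (⟦⟧-yes (n ≤? r + ℓ) n≤r+ℓ)) ⟩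
    (r + ℓ ∸ n) % n + n * 1          ≡⟨ cong₂ _+_ (m<n⇒m%n≡m excess<n) (*-identityʳ n) ⟩
    (r + ℓ ∸ n) + n                  ≡⟨ m∸n+n≡m n≤r+ℓ ⟩
    r + ℓ                            ∎
    where
    excess<n : r + ℓ ∸ n < n
    excess<n = +-cancelʳ-< n (r + ℓ ∸ n) n (subst (_< n + n) (sym (m∸n+n≡m n≤r+ℓ)) (+-mono-<-≤ r<n ℓ≤n))

  crossing-dist : ∀ j v ℓ → ⟦ n ≤? dist j v + ℓ ⟧ ≡ ⟦ dist (shift v 1) j <? ℓ ⟧
  crossing-dist j v ℓ = ⟦⟧-cong to from (n ≤? b + ℓ) (a <? ℓ)
    where
    a = dist (shift v 1) j
    b = dist j v
    total : suc a + b ≡ n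
    total = trans (sym (+-suc a b)) (dist-complement v j)
    to : n ≤ b + ℓ → a < ℓ
    to n≤b+ℓ = +-cancelʳ-≤ b (suc a) ℓ (subst₂ _≤_ (sym total) (+-comm b ℓ) n≤b+ℓ)
    from : a < ℓ → n ≤ b + ℓ
    from a<ℓ = subst₂ _≤_ total (+-comm ℓ b) (+-monoˡ-≤ b a<ℓ)

  dist-next : ∀ v j {k} → dist (shift v 1) j ≡ k → shift v (k + 1) ≡ j
  dist-next v j {k} eq = begin
    shift v (k + 1)                      ≡⟨ cong (shift v) (+-comm k 1) ⟩
    shift v (1 + k)                      ≡⟨ shift-shift v 1 k ⟨
    shift (shift v 1) k                  ≡⟨ cong (shift (shift v 1)) eq ⟨
    shift (shift v 1) (dist (shift v 1) j) ≡⟨ shift-dist (shift v 1) j ⟩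
    j                                    ∎

module Winding (n : ℕ) .{{_ : NonZero n}} (j : Fin n) where
  open ZMod n

  walk-laps : (pos : ℕ → Fin n) (ℓ : ℕ → ℕ) → (∀ t → ℓ t ≤ n) →
              ∀ T → (∀ t → t < T → pos (suc t) ≡ shift (pos t) (ℓ t)) →
              Σ< T ℓ + dist j (pos 0) ≡
              dist j (pos T) + n * Σ< T (λ t → ⟦ n ≤? dist j (pos t) + ℓ t ⟧)
  walk-laps pos ℓ ℓ≤n zero steps =
    sym (trans (cong (dist j (pos 0) +_) (*-zeroʳ n)) (+-identityʳ _))
  walk-laps pos ℓ ℓ≤n (suc T) steps = begin
    Σ< (suc T) ℓ + d₀                      ≡⟨ cong (_+ d₀) (Σ<-snoc T ℓ) ⟩
    Σ< T ℓ + ℓ T + d₀                      ≡⟨ swap (Σ< T ℓ) (ℓ T) d₀ ⟩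
    Σ< T ℓ + d₀ + ℓ T                      ≡⟨ cong (_+ ℓ T) (walk-laps pos ℓ ℓ≤n T (λ t t<T → steps t (m<n⇒m<1+n t<T))) ⟩
    r + n * X + ℓ T                        ≡⟨ swap r (n * X) (ℓ T) ⟩
    r + ℓ T + n * X                        ≡⟨ cong (_+ n * X) (wrap (dist<n j (pos T)) (ℓ≤n T)) ⟨
    (r + ℓ T) % n + n * c + n * X          ≡⟨ collect ((r + ℓ T) % n) n c X ⟩
    (r + ℓ T) % n + n * (X + c)            ≡⟨ cong₂ _+_ next-dist (cong (n *_) (Σ<-snoc T cross)) ⟨
    dist j (pos (suc T)) + n * Σ< (suc T) cross ∎
    where
    open ≡-Reasoning
    cross : ℕ → ℕ
    cross t = ⟦ n ≤? dist j (pos t) + ℓ t ⟧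
    d₀ = dist j (pos 0)
    r  = dist j (pos T)
    X  = Σ< T cross
    c  = cross T
    next-dist : dist j (pos (suc T)) ≡ (r + ℓ T) % n
    next-dist = trans (cong (dist j) (steps T ≤-refl)) (dist-shift j (pos T) (ℓ T))
    swap : ∀ a b c → a + b + c ≡ a + c + b
    swap = solve-∀
    collect : ∀ a n c x → a + n * c + n * x ≡ a + n * (x + c)
    collect = solve-∀

  closed-walk-laps : (pos : ℕ → Fin n) (ℓ : ℕ → ℕ) → (∀ t → ℓ t ≤ n) →
                     ∀ T m → (∀ t → t < T → pos (suc t) ≡ shift (pos t) (ℓ t)) →
                     pos T ≡ pos 0 → Σ< T ℓ ≡ m * n →
                     Σ< T (λ t → ⟦ n ≤? dist j (pos t) + ℓ t ⟧) ≡ m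
  closed-walk-laps pos ℓ ℓ≤n T m steps closed total = *-cancelʳ-≡ _ m n (begin
    X * n                  ≡⟨ *-comm X n ⟩
    n * X                  ≡⟨ +-cancelˡ-≡ (dist j (pos 0)) _ _ (begin
        dist j (pos 0) + n * X ≡⟨ cong (λ p → dist j p + n * X) closed ⟨
        dist j (pos T) + n * X ≡⟨ walk-laps pos ℓ ℓ≤n T steps ⟨
        Σ< T ℓ + dist j (pos 0) ≡⟨ +-comm (Σ< T ℓ) _ ⟩
        dist j (pos 0) + Σ< T ℓ ∎) ⟩
    Σ< T ℓ                 ≡⟨ total ⟩
    m * n                  ∎)
    where
    open ≡-Reasoning
    X = Σ< T (λ t → ⟦ n ≤? dist j (pos t) + ℓ t ⟧)

module CycleCrossings (n k : ℕ) .{{_ : NonZero n}} (k<n : k < n)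
                      {n2 n3} (cy : Cycle n k n2 n3) where
  open Cycle cy
  open ZMod n

  L = n2 + n3

  len : ℕ → ℕ
  len t = k + b2n (long t)

  len≤n : ∀ t → len t ≤ n
  len≤n t = ≤-trans (+-monoʳ-≤ k (b2n≤1 (long t))) (≤-trans (≤-reflexive (+-comm k 1)) k<n)

  cycle-length : Σ< L len ≡ k * n2 + (k + 1) * n3
  cycle-length = begin
    Σ< L len                                  ≡⟨ Σ<-+ L (λ _ → k) (b2n ∘ long) ⟩
    Σ< L (λ _ → k) + Σ< L (b2n ∘ long)        ≡⟨ cong₂ _+_ (Σℕ-const L k) (sym (countTrue-Σ< long L)) ⟩
    L * k + countTrue long L                  ≡⟨ cong (L * k +_) nLong ⟩
    (n2 + n3) * k + n3                        ≡⟨ rearrange n2 n3 k ⟩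
    k * n2 + (k + 1) * n3                     ∎
    where
    open ≡-Reasoning
    rearrange : ∀ a b k → (a + b) * k + b ≡ k * a + (k + 1) * b
    rearrange = solve-∀

  -- The cycle winds n1 times around Z_n, so exactly n1 of its arcs pass over
  -- any column j; an arc v → v + ℓ passes over j iff dist (v+1) j < ℓ.
  crossings : ∀ j {n1} → n1 * n ≡ k * n2 + (k + 1) * n3 →
              Σ< L (λ t → ⟦ dist (shift (vert t) 1) j <? len t ⟧) ≡ n1
  crossings j {n1} winding = begin
    Σ< L (λ t → ⟦ dist (shift (vert t) 1) j <? len t ⟧) ≡⟨ Σ<-cong L (λ t → crossing-dist j (vert t) (len t)) ⟨
    Σ< L (λ t → ⟦ n ≤? dist j (vert t) + len t ⟧)     ≡⟨ closed-walk-laps vert len len≤n L n1 step closed (trans cycle-length (sym winding)) ⟩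
    n1                                                 ∎
    where
    open ≡-Reasoning
    open Winding n j

  crossings-split : ∀ j {n1} → n1 * n ≡ k * n2 + (k + 1) * n3 →
    Σ< L (λ t → ⟦ dist (shift (vert t) 1) j <? k ⟧) +
    Σ< L (λ t → b2n (long t) * ⟦ dist (shift (vert t) 1) j ≟ k ⟧) ≡ n1
  crossings-split j winding = trans (sym (Σ<-+ L (λ t → ⟦ a t <? k ⟧) (λ t → b2n (long t) * ⟦ a t ≟ k ⟧)))
    (trans (Σ<-cong L (λ t → sym (split (a t) (long t)))) (crossings j winding))
    where
    a : ℕ → ℕ
    a t = dist (shift (vert t) 1) j
    split : ∀ a b → ⟦ a <? k + b2n b ⟧ ≡ ⟦ a <? k ⟧ + b2n b * ⟦ a ≟ k ⟧
    split a false = trans (cong (λ m → ⟦ a <? m ⟧) (+-identityʳ k)) (sym (+-identityʳ _))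
    split a true  = trans (cong (λ m → ⟦ a <? m ⟧) (+-comm k 1))
                          (trans (⟦<suc⟧ a k) (cong (⟦ a <? k ⟧ +_) (sym (+-identityʳ _))))

module Minor (n k : ℕ) .{{_ : NonZero n}} (k+2≤n : k + 2 ≤ n)
             (W : Fin n → Bool) (n′ k′ : ℕ) (dm : DefinesMinor n k W n′ k′) where
  open DefinesMinor dm
  open ZMod n

  k<n : k < n
  k<n = ≤-trans (≤-reflexive (+-comm 1 k)) (≤-trans (+-monoʳ-≤ k (s≤s z≤n)) k+2≤n)

  k+1≤n : k + 1 ≤ n
  k+1≤n = ≤-trans (≤-reflexive (+-comm k 1)) k<n

  L = n2 + n3

  vtx : Fin d → ℕ → Fin n
  vtx c = Cycle.vert (cyc c)

  ΣN : (Fin d → ℕ → ℕ) → ℕ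
  ΣN h = Σℕ (λ c → Σ< L (h c))

  -- Distinct positions in the cycles are distinct vertices, so a 0/1 weight
  -- supported on at most one vertex sums to at most one over N.
  ΣN-≤1 : (h : Fin d → ℕ → ℕ) → (∀ c t → h c t ≤ 1) →
          (∀ c c′ t t′ → t < L → t′ < L → 1 ≤ h c t → 1 ≤ h c′ t′ → vtx c t ≡ vtx c′ t′) →
          ΣN h ≤ 1
  ΣN-≤1 h bound same-vertex = Σℕ-≤1 _ within-cycle across-cycles
    where
    within-cycle : ∀ c → Σ< L (h c) ≤ 1
    within-cycle c = Σℕ-≤1 _ (λ t → bound c (toℕ t)) λ t t′ p q →
      Fin.toℕ-injective (Cycle.simple (cyc c) _ _ (Fin.toℕ<n t) (Fin.toℕ<n t′)
        (same-vertex c c _ _ (Fin.toℕ<n t) (Fin.toℕ<n t′) p q))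
    across-cycles : ∀ c c′ → 1 ≤ Σ< L (h c) → 1 ≤ Σ< L (h c′) → c ≡ c′
    across-cycles c c′ p q with Σℕ-witness _ p | Σℕ-witness _ q
    ... | t , ht | t′ , ht′ = disjoint c c′ (vtx c (toℕ t)) (toℕ t , Fin.toℕ<n t , refl)
      (toℕ t′ , Fin.toℕ<n t′ , sym (same-vertex c c′ _ _ (Fin.toℕ<n t) (Fin.toℕ<n t′) ht ht′))

  ΣN-+ : (f g : Fin d → ℕ → ℕ) → ΣN (λ c t → f c t + g c t) ≡ ΣN f + ΣN g
  ΣN-+ f g = trans (Σℕ-cong (λ c → Σ<-+ L (f c) (g c))) (Σℕ-+ (λ c → Σ< L (f c)) (λ c → Σ< L (g c)))

  ΣN-*ʳ : ∀ a (h : Fin d → ℕ → ℕ) → ΣN h * a ≡ ΣN (λ c t → h c t * a)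
  ΣN-*ʳ a h = sym (trans (Σℕ-cong (λ c → Σℕ-*ʳ a (λ (t : Fin L) → h c (toℕ t))))
                         (Σℕ-*ʳ a (λ c → Σ< L (h c))))

  ΣN-const : ∀ a → ΣN (λ _ _ → a) ≡ d * (L * a)
  ΣN-const a = trans (Σℕ-cong (λ (c : Fin d) → Σℕ-const L a)) (Σℕ-const d (L * a))

  ΣN-multiplicity : (p : Fin d → ℕ → Fin n) (g : Fin n → ℕ) →
    Σℕ (λ i → ΣN (λ c t → ⟦ p c t Fin.≟ i ⟧) * g i) ≡ ΣN (λ c t → g (p c t))
  ΣN-multiplicity p g = begin
    Σℕ (λ i → ΣN (λ c t → δ c t i) * g i)                    ≡⟨ Σℕ-cong (λ i → ΣN-*ʳ (g i) (λ c t → δ c t i)) ⟩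
    Σℕ (λ i → Σℕ (λ c → Σ< L (λ t → δ c t i * g i)))         ≡⟨ Σℕ-swap (λ i (c : Fin d) → Σ< L (λ t → δ c t i * g i)) ⟩
    Σℕ (λ c → Σℕ (λ i → Σ< L (λ t → δ c t i * g i)))         ≡⟨ Σℕ-cong (λ c → Σℕ-swap (λ i (t : Fin L) → δ c (toℕ t) i * g i)) ⟩
    Σℕ (λ c → Σ< L (λ t → Σℕ (λ i → δ c t i * g i)))         ≡⟨ Σℕ-cong (λ c → Σ<-cong L (λ t → Σℕ-point (p c t) g)) ⟩
    ΣN (λ c t → g (p c t))                                   ∎
    where
    open ≡-Reasoning
    δ : Fin d → ℕ → Fin n → ℕ
    δ c t i = ⟦ p c t Fin.≟ i ⟧

  -- mult i is the number of v ∈ N with v + 1 = i (0 or 1); the rows of the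
  -- minor are the rows i with i - 1 ∉ N, those with keep i = 1.
  mult : Fin n → ℕ
  mult i = ΣN (λ c t → ⟦ shift (vtx c t) 1 Fin.≟ i ⟧)

  keep : Fin n → ℕ
  keep i = 1 ∸ mult i

  -- Distinct vertices of N have distinct successors, so mult i ≤ 1.
  mult≤1 : ∀ i → mult i ≤ 1
  mult≤1 i = ΣN-≤1 _ (λ c t → ⟦⟧≤1 (shift (vtx c t) 1 Fin.≟ i)) λ c c′ t t′ _ _ p q →
    shift-injective (≤-trans (s≤s z≤n) k<n)
      (trans (⟦⟧-sound (_ Fin.≟ i) p) (sym (⟦⟧-sound (_ Fin.≟ i) q)))

  keep+mult : ∀ i → keep i + mult i ≡ 1
  keep+mult i = m∸n+n≡m (mult≤1 i)

  Σkeep : Σℕ keep ≡ n′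
  Σkeep = +-cancelʳ-≡ (d * L) _ _ (begin
    Σℕ keep + d * L       ≡⟨ cong (Σℕ keep +_) Σmult ⟨
    Σℕ keep + Σℕ mult     ≡⟨ Σℕ-+ keep mult ⟨
    Σℕ (λ i → keep i + mult i) ≡⟨ Σℕ-cong keep+mult ⟩
    Σℕ {n} (λ _ → 1)     ≡⟨ trans (Σℕ-const n 1) (*-identityʳ n) ⟩
    n                     ≡⟨ n'-eq ⟨
    n′ + d * L            ∎)
    where
    open ≡-Reasoning
    Σmult : Σℕ mult ≡ d * L
    Σmult = begin
      Σℕ mult                      ≡⟨ Σℕ-cong (λ i → *-identityʳ (mult i)) ⟨
      Σℕ (λ i → mult i * 1)        ≡⟨ ΣN-multiplicity (λ c t → shift (vtx c t) 1) (λ _ → 1) ⟩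
      ΣN (λ _ _ → 1)               ≡⟨ ΣN-const 1 ⟩
      d * (L * 1)                  ≡⟨ cong (d *_) (*-identityʳ L) ⟩
      d * L                        ∎

  colsum : Fin n → ℕ
  colsum j = Σℕ (λ i → keep i * C n k i j)

  module Column (j : Fin n) where
    open CycleCrossings n k k<n using (crossings-split)

    long : Fin d → ℕ → Bool
    long c = Cycle.long (cyc c)

    gap : Fin d → ℕ → ℕ
    gap c t = dist (shift (vtx c t) 1) j

    -- Y counts the deleted rows meeting column j; X counts the long arcs of N ending at j.
    Y X : ℕ
    Y = ΣN (λ c t → ⟦ gap c t <? k ⟧)
    X = ΣN (λ c t → b2n (long c t) * ⟦ gap c t ≟ k ⟧)

    -- Column j of C_n^k has (at most) k ones: its rows have distinct distances to j.
    column-size : Σℕ (λ i → C n k i j) ≤ k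
    column-size = count-injective (λ i → dist i j) (λ i i′ → dist-injective j) k

    deleted-rows : Σℕ (λ i → mult i * C n k i j) ≡ Y
    deleted-rows = ΣN-multiplicity (λ c t → shift (vtx c t) 1) (λ i → C n k i j)

    -- Every cycle passes over column j exactly n1 times.
    Y+X : Y + X ≡ d * n1
    Y+X = begin
      Y + X                     ≡⟨ ΣN-+ (λ c t → ⟦ gap c t <? k ⟧) (λ c t → b2n (long c t) * ⟦ gap c t ≟ k ⟧) ⟨
      Σℕ (λ c → Σ< L (λ t → ⟦ gap c t <? k ⟧ + b2n (long c t) * ⟦ gap c t ≟ k ⟧))
                                ≡⟨ Σℕ-cong per-cycle ⟩
      Σℕ {d} (λ _ → n1)         ≡⟨ Σℕ-const d n1 ⟩
      d * n1                    ∎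
      where
      open ≡-Reasoning
      per-cycle : ∀ c → Σ< L (λ t → ⟦ gap c t <? k ⟧ + b2n (long c t) * ⟦ gap c t ≟ k ⟧) ≡ n1
      per-cycle c = trans (Σ<-+ L (λ t → ⟦ gap c t <? k ⟧) (λ t → b2n (long c t) * ⟦ gap c t ≟ k ⟧))
                          (crossings-split (cyc c) j n1-eq)

    arc-start : ∀ c t → 1 ≤ b2n (long c t) * ⟦ gap c t ≟ k ⟧ → vtx c t ≡ unshift j (k + 1)
    arc-start c t p with ∧-indicator-sound (long c t) (gap c t ≟ k) p
    ... | _ , gap≡k = trans (sym (unshift-shift (vtx c t) k+1≤n))
                            (cong (λ v → unshift v (k + 1)) (dist-next (vtx c t) j gap≡k))

    -- All long arcs ending at j start at the same vertex, so there is at most one.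
    X≤1 : X ≤ 1
    X≤1 = ΣN-≤1 _ (λ c t → ∧-indicator≤1 (long c t) (gap c t ≟ k))
      (λ c c′ t t′ _ _ p q → trans (arc-start c t p) (sym (arc-start c′ t′ q)))

    -- A long arc of N ending at j puts both j and j - (k+1) into the same N^c, i.e. j ∈ W.
    X⇒W : 1 ≤ X → W j ≡ true
    X⇒W X≥1 with Σℕ-witness _ X≥1
    ... | c , p with Σℕ-witness _ p
    ... | t′ , q = Equivalence.from (W-def j) (c , j-in-cycle , (t , t<L , arc-start c t q))
      where
      open Cycle (cyc c) using (vert; step; closed)
      t = toℕ t′
      t<L = Fin.toℕ<n t′
      arrives : vert (suc t) ≡ j
      arrives with ∧-indicator-sound (long c t) (gap c t ≟ k) q
      ... | is-long , gap≡k = trans (step t t<L)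
        (trans (cong (λ b → shift (vert t) (k + b2n b)) is-long) (dist-next (vert t) j gap≡k))
      j-in-cycle : InCycle (cyc c) j
      j-in-cycle with m≤n⇒m<n∨m≡n t<L
      ... | inj₁ t+1<L = suc t , t+1<L , arrives
      ... | inj₂ t+1≡L = 0 , ≤-trans (s≤s z≤n) t<L , trans (sym closed) (trans (cong vert (sym t+1≡L)) arrives)

    colsum+Y : colsum j + Y ≡ Σℕ (λ i → C n k i j)
    colsum+Y = begin
      colsum j + Y                                      ≡⟨ cong (colsum j +_) deleted-rows ⟨
      colsum j + Σℕ (λ i → mult i * C n k i j)          ≡⟨ Σℕ-+ (λ i → keep i * C n k i j) (λ i → mult i * C n k i j) ⟨
      Σℕ (λ i → keep i * C n k i j + mult i * C n k i j) ≡⟨ Σℕ-cong (λ i → trans (sym (*-distribʳ-+ (C n k i j) (keep i) (mult i)))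
                                                                      (trans (cong (_* C n k i j) (keep+mult i)) (*-identityˡ _))) ⟩
      Σℕ (λ i → C n k i j)                              ∎
      where open ≡-Reasoning

    colsum≤k′+X : colsum j ≤ k′ + X
    colsum≤k′+X = +-cancelʳ-≤ Y (colsum j) (k′ + X) (begin
      colsum j + Y          ≡⟨ colsum+Y ⟩
      Σℕ (λ i → C n k i j)  ≤⟨ column-size ⟩
      k                     ≡⟨ k'-eq ⟨
      k′ + d * n1           ≡⟨ cong (k′ +_) Y+X ⟨
      k′ + (Y + X)          ≡⟨ rearrange k′ Y X ⟩
      k′ + X + Y            ∎)
      where
      open ≤-Reasoning
      rearrange : ∀ a b c → a + (b + c) ≡ a + c + b
      rearrange = solve-∀

  colsum-bound : ∀ j → colsum j ≤ coef W j * k′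
  colsum-bound j with W j in Wj
  ... | true  = ≤-trans colsum≤k′+X (≤-trans (+-monoʳ-≤ k′ (≤-trans X≤1 (≤-trans (s≤s z≤n) k'-lo)))
                                             (≤-reflexive (cong (k′ +_) (sym (+-identityʳ k′)))))
    where open Column j
  ... | false = ≤-trans colsum≤k′+X (≤-reflexive (cong (k′ +_) X≡0))
    where
    open Column j
    X≡0 : X ≡ 0
    X≡0 with X in eqX
    ... | zero  = refl
    ... | suc _ with trans (sym Wj) (X⇒W (≤-trans (s≤s z≤n) (≤-reflexive (sym eqX))))
    ...   | ()

ceilDiv-spec : ∀ a D → a ≤ ceilDiv a (suc D) * suc D
ceilDiv-spec a D = +-cancelʳ-≤ D a _ (begin
  a + D                                  ≡⟨ m≡m%n+[m/n]*n (a + D) (suc D) ⟩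
  (a + D) % suc D + ceilDiv a (suc D) * suc D ≤⟨ +-monoˡ-≤ _ (≤-pred (m%n<n (a + D) (suc D))) ⟩
  D + ceilDiv a (suc D) * suc D          ≡⟨ +-comm D _ ⟩
  ceilDiv a (suc D) * suc D + D          ∎)
  where open ≤-Reasoning

ceilDiv-least : ∀ a D c → a ≤ c * suc D → ceilDiv a (suc D) ≤ c
ceilDiv-least a D c a≤cs = ≤-pred (m<n*o⇒m/o<n (begin-strict
  a + D              <⟨ +-monoʳ-< a (n<1+n D) ⟩
  a + suc D          ≤⟨ +-monoˡ-≤ (suc D) a≤cs ⟩
  c * suc D + suc D  ≡⟨ +-comm (c * suc D) (suc D) ⟩
  suc c * suc D      ∎))
  where open ≤-Reasoning

ceilDiv-scale : ∀ N D a K → N * suc K ≡ a * suc D → ceilDiv N (suc D) ≡ ceilDiv a (suc K)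
ceilDiv-scale N D a K eq = ≤-antisym
  (ceilDiv-least N D _ (scale-bound N D a K eq {ceilDiv a (suc K)} (ceilDiv-spec a K)))
  (ceilDiv-least a K _ (scale-bound a K N D (sym eq) {ceilDiv N (suc D)} (ceilDiv-spec N D)))
  where
  scale-bound : ∀ N D a K → N * suc K ≡ a * suc D → ∀ {c} → a ≤ c * suc K → N ≤ c * suc D
  scale-bound N D a K eq {c} a≤c = *-cancelʳ-≤ N (c * suc D) (suc K) (begin
    N * suc K          ≡⟨ eq ⟩
    a * suc D          ≤⟨ *-monoˡ-≤ (suc D) a≤c ⟩
    c * suc K * suc D  ≡⟨ swap c (suc K) (suc D) ⟩
    c * suc D * suc K  ∎)
    where
    open ≤-Reasoning
    swap : ∀ x y z → x * y * z ≡ x * z * y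
    swap = solve-∀

ceilDiv-exact : ∀ c D → ceilDiv (c * suc D) (suc D) ≡ c
ceilDiv-exact c D = trans (ceilDiv-scale (c * suc D) D c 0 (*-identityʳ _))
                          (trans (n/1≡n (c + 0)) (+-identityʳ c))

-- The constructors +_ and -[1+_] of ℤ are opened only from here on: the prefix
-- operator +_ would make the ℕ sections (x +_) used above ambiguous.
open import Data.Integer as ℤ using (+_; -[1+_])

quotient : ∀ r q D → r < suc D → (r + q * suc D) / suc D ≡ q
quotient r q D r<s = trans (+-distrib-/-∣ʳ r (n∣m*n q))
                           (cong₂ _+_ (m<n⇒m/n≡0 r<s) (m*n/n≡m q (suc D)))

ceiling-mkℚ : ∀ N D .(c : Coprime N (suc D)) → ceiling (mkℚ (+ N) D c) ≡ + ceilDiv N (suc D)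
ceiling-mkℚ zero    D c = cong +_ (sym (m<n⇒m/n≡0 (n<1+n D)))
ceiling-mkℚ (suc m) D c with suc m % suc D in rem
... | zero  = begin
  ℤ.- (+ 1 ℤ.* ℤ.- (+ q))  ≡⟨ cong ℤ.-_ (ℤ.*-identityˡ (ℤ.- (+ q))) ⟩
  ℤ.- ℤ.- (+ q)            ≡⟨ ℤ.neg-involutive (+ q) ⟩
  + q                      ≡⟨ cong +_ (quotient D q D ≤-refl) ⟨
  + ((D + q * suc D) / suc D) ≡⟨ cong (λ x → + (x / suc D)) (+-comm D (q * suc D)) ⟩
  + ((q * suc D + D) / suc D) ≡⟨ cong (λ x → + ((x + D) / suc D)) split ⟨
  + ceilDiv (suc m) (suc D) ∎
  where
  open ≡-Reasoning
  q = suc m / suc D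
  split : suc m ≡ q * suc D
  split = trans (m≡m%n+[m/n]*n (suc m) (suc D)) (cong (_+ q * suc D) rem)
... | suc r = cong +_ (sym (begin
  (suc m + D) / suc D           ≡⟨ cong (λ x → (x + D) / suc D) split ⟩
  (suc r + q * suc D + D) / suc D ≡⟨ cong (_/ suc D) (rearrange r q D) ⟩
  (r + suc q * suc D) / suc D   ≡⟨ quotient r (suc q) D r<D+1 ⟩
  suc q                         ≡⟨ cong suc (+-identityʳ q) ⟨
  suc (q + 0)                   ∎))
  where
  open ≡-Reasoning
  q = suc m / suc D
  split : suc m ≡ suc r + q * suc D
  split = trans (m≡m%n+[m/n]*n (suc m) (suc D)) (cong (_+ q * suc D) rem)
  r<D+1 : r < suc D
  r<D+1 = <-trans (n<1+n r) (subst (_< suc D) rem (m%n<n (suc m) (suc D)))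
  rearrange : ∀ r q D → suc r + q * suc D + D ≡ r + suc q * suc D
  rearrange = solve-∀

-- frac a K is the rational a / (K+1).
frac : ℕ → ℕ → ℚ
frac a K = fromℚᵘ (mkℚᵘ (+ a) K)

fromℚᵘ-+ : ∀ p q → fromℚᵘ p ℚ.+ fromℚᵘ q ≡ fromℚᵘ (p ℚᵘ.+ q)
fromℚᵘ-+ p q = ℚ.toℚᵘ-injective (begin
  toℚᵘ (fromℚᵘ p ℚ.+ fromℚᵘ q)              ≈⟨ ℚ.toℚᵘ-homo-+ (fromℚᵘ p) (fromℚᵘ q) ⟩
  toℚᵘ (fromℚᵘ p) ℚᵘ.+ toℚᵘ (fromℚᵘ q)      ≈⟨ ℚᵘ.+-cong (ℚ.toℚᵘ-fromℚᵘ p) (ℚ.toℚᵘ-fromℚᵘ q) ⟩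
  p ℚᵘ.+ q                                   ≈⟨ ℚ.toℚᵘ-fromℚᵘ (p ℚᵘ.+ q) ⟨
  toℚᵘ (fromℚᵘ (p ℚᵘ.+ q))                  ∎)
  where open ℚᵘ.≃-Reasoning

fromℚᵘ-* : ∀ p q → fromℚᵘ p ℚ.* fromℚᵘ q ≡ fromℚᵘ (p ℚᵘ.* q)
fromℚᵘ-* p q = ℚ.toℚᵘ-injective (begin
  toℚᵘ (fromℚᵘ p ℚ.* fromℚᵘ q)              ≈⟨ ℚ.toℚᵘ-homo-* (fromℚᵘ p) (fromℚᵘ q) ⟩
  toℚᵘ (fromℚᵘ p) ℚᵘ.* toℚᵘ (fromℚᵘ q)      ≈⟨ ℚᵘ.*-cong (ℚ.toℚᵘ-fromℚᵘ p) (ℚ.toℚᵘ-fromℚᵘ q) ⟩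
  p ℚᵘ.* q                                   ≈⟨ ℚ.toℚᵘ-fromℚᵘ (p ℚᵘ.* q) ⟨
  toℚᵘ (fromℚᵘ (p ℚᵘ.* q))                  ∎)
  where open ℚᵘ.≃-Reasoning

mk-+ : ∀ a b K → mkℚᵘ (+ a) K ℚᵘ.+ mkℚᵘ (+ b) K ℚᵘ.≃ mkℚᵘ (+ (a + b)) K
mk-+ a b K = *≡* (trans (identity (+ a) (+ b) (+ suc K))
  (sym (cong₂ ℤ._*_ (ℤ.pos-+ a b) (ℤ.pos-* (suc K) (suc K)))))
  where
  identity : ∀ a b s → (a ℤ.* s ℤ.+ b ℤ.* s) ℤ.* s ≡ (a ℤ.+ b) ℤ.* (s ℤ.* s)
  identity = ℤ-Solver.solve-∀

mk-* : ∀ b c K → mkℚᵘ (+ b) K ℚᵘ.* mkℚᵘ (+ c) 0 ℚᵘ.≃ mkℚᵘ (+ (b * c)) K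
mk-* b c K = *≡* (trans (identity (+ b) (+ c) (+ suc K))
  (sym (cong₂ ℤ._*_ (ℤ.pos-* b c) (ℤ.pos-* (suc K) 1))))
  where
  identity : ∀ b c s → b ℤ.* c ℤ.* s ≡ b ℤ.* c ℤ.* (s ℤ.* + 1)
  identity = ℤ-Solver.solve-∀

frac-+ : ∀ a b K → frac a K ℚ.+ frac b K ≡ frac (a + b) K
frac-+ a b K = trans (fromℚᵘ-+ (mkℚᵘ (+ a) K) (mkℚᵘ (+ b) K)) (ℚ.fromℚᵘ-cong (mk-+ a b K))

frac-* : ∀ b c K → frac b K ℚ.* ℕ→ℚ c ≡ frac (b * c) K
frac-* b c K = trans (fromℚᵘ-* (mkℚᵘ (+ b) K) (mkℚᵘ (+ c) 0)) (ℚ.fromℚᵘ-cong (mk-* b c K))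

frac-0 : ∀ K → 0ℚ ≡ frac 0 K
frac-0 K = ℚ.fromℚᵘ-cong {mkℚᵘ (+ 0) 0} {mkℚᵘ (+ 0) K} (*≡* refl)

Σℚ-cong : {f g : Fin n → ℚ} → (∀ i → f i ≡ g i) → Σℚ f ≡ Σℚ g
Σℚ-cong {zero}  e = refl
Σℚ-cong {suc n} e = cong₂ ℚ._+_ (e Fin.zero) (Σℚ-cong (λ i → e (Fin.suc i)))

Σℚ-zero : ∀ n → Σℚ {n} (λ _ → 0ℚ) ≡ 0ℚ
Σℚ-zero zero    = refl
Σℚ-zero (suc n) = trans (ℚ.+-identityˡ _) (Σℚ-zero n)

Σℚ-frac : (f : Fin n → ℕ) → ∀ K → Σℚ (λ i → frac (f i) K) ≡ frac (Σℕ f) K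
Σℚ-frac {zero}  f K = frac-0 K
Σℚ-frac {suc n} f K = trans (cong (frac (f Fin.zero) K ℚ.+_) (Σℚ-frac (λ i → f (Fin.suc i)) K))
                            (frac-+ (f Fin.zero) _ K)

frac-nonneg : ∀ a K → 0ℚ ℚ.≤ frac a K
frac-nonneg a K = ℚ.nonNegative⁻¹ (frac a K) {{ℚ.normalize-nonNeg a (suc K)}}

ceiling-frac : ∀ a K → ceiling (frac a K) ≡ + ceilDiv a (suc K)
ceiling-frac a K with frac a K | ℚ.toℚᵘ-fromℚᵘ (mkℚᵘ (+ a) K)
... | mkℚ (+ N) D c | *≡* eq = trans (ceiling-mkℚ N D c)
  (cong +_ (ceilDiv-scale N D a K (ℤ.+-injective (trans (ℤ.pos-* N (suc K)) (trans eq (sym (ℤ.pos-* a (suc D))))))))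
... | mkℚ -[1+ _ ] D c | *≡* eq with trans eq (sym (ℤ.pos-* a (suc D)))
...   | ()

weighted-cover : (A : Fin m → Fin n → ℕ) (b : Fin m → ℕ) (x : Fin n → ℕ) →
                 (∀ i → 1 ≤ Σℕ (λ j → A i j * x j)) →
                 Σℕ b ≤ Σℕ (λ j → x j * Σℕ (λ i → b i * A i j))
weighted-cover {m} A b x covers = begin
  Σℕ b                                          ≤⟨ Σℕ-mono (λ i → subst (_≤ b i * Ax i) (*-identityʳ (b i)) (*-monoʳ-≤ (b i) (covers i))) ⟩
  Σℕ (λ i → b i * Ax i)                         ≡⟨ Σℕ-cong (λ i → Σℕ-*ˡ (b i) (λ j → A i j * x j)) ⟨
  Σℕ (λ i → Σℕ (λ j → b i * (A i j * x j)))      ≡⟨ Σℕ-swap (λ i j → b i * (A i j * x j)) ⟩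
  Σℕ (λ j → Σℕ (λ i → b i * (A i j * x j)))      ≡⟨ Σℕ-cong (λ j → trans (Σℕ-cong (λ i → regroup (b i) (A i j) (x j)))
                                                                       (Σℕ-*ˡ (x j) (λ i → b i * A i j))) ⟩
  Σℕ (λ j → x j * Σℕ (λ i → b i * A i j))        ∎
  where
  open ≤-Reasoning
  Ax : Fin m → ℕ
  Ax i = Σℕ (λ j → A i j * x j)
  regroup : ∀ p q r → p * (q * r) ≡ r * (p * q)
  regroup p q r = trans (sym (*-assoc p q r)) (*-comm (p * q) r)

valid-from-weights : ∀ n k .{{_ : NonZero n}} (b a : Fin n → ℕ) K →
  (∀ j → Σℕ (λ i → b i * C n k i j) ≤ a j * suc K) →
  ValidQ* n k a (ceilDiv (Σℕ b) (suc K))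
valid-from-weights n k b a K col-bound x cover = ceilDiv-least (Σℕ b) K _ (begin
  Σℕ b                                                   ≤⟨ weighted-cover (C n k) b (b2n ∘ x) cover ⟩
  Σℕ (λ j → b2n (x j) * Σℕ (λ i → b i * C n k i j))      ≤⟨ Σℕ-mono (λ j → *-monoʳ-≤ (b2n (x j)) (col-bound j)) ⟩
  Σℕ (λ j → b2n (x j) * (a j * suc K))                   ≡⟨ Σℕ-cong (λ j → regroup (b2n (x j)) (a j) (suc K)) ⟩
  Σℕ (λ j → a j * b2n (x j) * suc K)                     ≡⟨ Σℕ-*ʳ (suc K) (λ j → a j * b2n (x j)) ⟩
  Σℕ (λ j → a j * b2n (x j)) * suc K                     ∎)
  where
  open ≤-Reasoning
  regroup : ∀ p q r → p * (q * r) ≡ q * p * r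
  regroup p q r = trans (sym (*-assoc p q r)) (cong (_* r) (*-comm p q))

-- ... and it is a Chvátal–Gomory cut of rank ≤ 1: take the multipliers
-- u_i = b_i/(K+1) on the rows, v_j = (a_j (K+1) − Σ_i b_i C_ij)/(K+1) on x ≥ 0
-- and w = 0 on x ≤ 1; then uᵀC + vᵀ = a and uᵀ1 = Σ b/(K+1).
cg-from-weights : ∀ n k .{{_ : NonZero n}} (b a : Fin n → ℕ) K →
  (∀ j → Σℕ (λ i → b i * C n k i j) ≤ a j * suc K) →
  CGRank≤1 n k a (ceilDiv (Σℕ b) (suc K))
cg-from-weights n k b a K col-bound =
  u , v , w , (λ i → frac-nonneg (b i) K) , (λ j → frac-nonneg (slack j) K) , (λ _ → ℚ.≤-refl) ,
  column , ℤ.≤-reflexive (sym right-hand-side)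
  where
  col slack : Fin n → ℕ
  col j = Σℕ (λ i → b i * C n k i j)
  slack j = a j * suc K ∸ col j
  u v w : Fin n → ℚ
  u i = frac (b i) K
  v j = frac (slack j) K
  w _ = 0ℚ

  minus-0 : ∀ p → p ℚ.- 0ℚ ≡ p
  minus-0 = ℚ.+-identityʳ

  column : ∀ j → ceiling (Σℚ (λ i → u i ℚ.* ℕ→ℚ (C n k i j)) ℚ.+ v j ℚ.- w j) ≡ + a j
  column j = begin
    ceiling (Σℚ (λ i → u i ℚ.* ℕ→ℚ (C n k i j)) ℚ.+ v j ℚ.- 0ℚ)
      ≡⟨ cong ceiling (minus-0 (Σℚ (λ i → u i ℚ.* ℕ→ℚ (C n k i j)) ℚ.+ v j)) ⟩
    ceiling (Σℚ (λ i → frac (b i) K ℚ.* ℕ→ℚ (C n k i j)) ℚ.+ v j)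
      ≡⟨ cong (λ p → ceiling (p ℚ.+ v j)) (trans (Σℚ-cong (λ i → frac-* (b i) (C n k i j) K)) (Σℚ-frac (λ i → b i * C n k i j) K)) ⟩
    ceiling (frac (col j) K ℚ.+ frac (slack j) K)
      ≡⟨ cong ceiling (trans (frac-+ (col j) (slack j) K) (cong (λ c → frac c K) (m+[n∸m]≡n (col-bound j)))) ⟩
    ceiling (frac (a j * suc K) K)
      ≡⟨ ceiling-frac (a j * suc K) K ⟩
    + ceilDiv (a j * suc K) (suc K)
      ≡⟨ cong +_ (ceilDiv-exact (a j) K) ⟩
    + a j ∎
    where open ≡-Reasoning

  right-hand-side : ceiling (Σℚ u ℚ.- Σℚ w) ≡ + ceilDiv (Σℕ b) (suc K)
  right-hand-side = begin
    ceiling (Σℚ u ℚ.- Σℚ w)  ≡⟨ cong (λ p → ceiling (Σℚ u ℚ.- p)) (Σℚ-zero n) ⟩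
    ceiling (Σℚ u ℚ.- 0ℚ)    ≡⟨ cong ceiling (trans (minus-0 (Σℚ u)) (Σℚ-frac b K)) ⟩
    ceiling (frac (Σℕ b) K)  ≡⟨ ceiling-frac (Σℕ b) K ⟩
    + ceilDiv (Σℕ b) (suc K) ∎
    where open ≡-Reasoning

theorem3p3 : (n k : ℕ) → {{_ : NonZero n}} → 2 ≤ k → k + 2 ≤ n →
             (W : Fin n → Bool) (n' k' : ℕ) → DefinesMinor n k W n' k' →
             ValidQ* n k (coef W) (ceilDiv n' k') × CGRank≤1 n k (coef W) (ceilDiv n' k')
theorem3p3 n k _ k+2≤n W n′ zero    dm with DefinesMinor.k'-lo dm   -- k′ ≥ 2
... | ()
theorem3p3 n k _ k+2≤n W n′ (suc K) dm = valid , cg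
  where
  -- keep selects the n′ rows of the minor, and its columns are bounded by coef W · k′.
  open Minor n k k+2≤n W n′ (suc K) dm

  valid : ValidQ* n k (coef W) (ceilDiv n′ (suc K))
  valid = subst (λ rows → ValidQ* n k (coef W) (ceilDiv rows (suc K))) Σkeep
                (valid-from-weights n k keep (coef W) K colsum-bound)

  cg : CGRank≤1 n k (coef W) (ceilDiv n′ (suc K))
  cg = subst (λ rows → CGRank≤1 n k (coef W) (ceilDiv rows (suc K))) Σkeep
             (cg-from-weights n k keep (coef W) K colsum-bound)
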